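{- Let $G\in\mathcal{R}_{UVR}$ be a connected graph of order $n$. Then $\gamma_R(G)\le \frac{2}{3}n$. If equality $\gamma_R(G)=\frac23 n$ holds, then for every $\gamma_R$-function $f$ on $G$, the set $V_2^f$ is an efficient dominating set of $G$ and every vertex of $V_2^f$ has degree $2$. Conversely, if $G$ has an efficient dominating set $D$ all of whose vertices have degree $2$, then $\gamma_R(G)=\frac23 n$.
   Context: All graphs are finite, simple and undirected. A Roman dominating function (RDF) on $G$ is a map $f:V(G)\to\{0,1,2\}$ such that every vertex with $f$-value $0$ has a neighbor with $f$-value $2$; $V_i^f=\{v:f(v)=i\}$. The weight of $f$ is $\sum_v f(v)$, $\gamma_R(G)$ is the minimum weight of an RDF, and a $\gamma_R$-function is an RDF of weight $\gamma_R(G)$. $\mathcal{R}_{UVR}$ is the class of graphs $G$ with $\gamma_R(G-v)=\gamma_R(G)$ for all $v\in V(G)$. An efficient dominating set of $G$ is a set $S\subseteq V(G)$ such that the closed neighborhoods $\{N[s]: s\in S\}$ form a partition of $V(G)$. -}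

module Defs where

open import Data.Nat using (ℕ; zero; suc; _+_; _≤_)
open import Data.Fin using (Fin; zero; suc; toℕ; punchIn)
open import Data.Bool using (Bool; true; false; if_then_else_)
open import Data.List using (List; map; allFin)
open import Data.Nat.ListAction using (sum)
open import Data.Product using (Σ; ∃; _×_; _,_)
open import Data.Sum using (_⊎_)
open import Relation.Binary.PropositionalEquality using (_≡_)
open import Relation.Nullary using (¬_)

record Graph (n : ℕ) : Set where
  field
    adj    : Fin n → Fin n → Bool
    sym    : ∀ i j → adj i j ≡ adj j i
    irrefl : ∀ i → adj i i ≡ false
open Graph public

deg : ∀ {n} → Graph n → Fin n → ℕ
deg {n} G v = sum (map (λ u → if adj G v u then 1 else 0) (allFin n))

data Walk {n} (G : Graph n) : Fin n → Fin n → Set where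
  here : ∀ {u} → Walk G u u
  step : ∀ {u w v} → adj G u w ≡ true → Walk G w v → Walk G u v

Connected : ∀ {n} → Graph n → Set
Connected G = ∀ u v → Walk G u v

_─_ : ∀ {m} → Graph (suc m) → Fin (suc m) → Graph m
adj    (G ─ v) i j = adj G (punchIn v i) (punchIn v j)
sym    (G ─ v) i j = sym G (punchIn v i) (punchIn v j)
irrefl (G ─ v) i   = irrefl G (punchIn v i)

two : Fin 3
two = suc (suc zero)

IsRDF : ∀ {n} → Graph n → (Fin n → Fin 3) → Set
IsRDF G f = ∀ v → f v ≡ zero → ∃ λ u → adj G v u ≡ true × f u ≡ two

weight : ∀ {n} → (Fin n → Fin 3) → ℕ
weight {n} f = sum (map (λ v → toℕ (f v)) (allFin n))

IsγRFunction : ∀ {n} → Graph n → (Fin n → Fin 3) → Set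
IsγRFunction G f = IsRDF G f × (∀ g → IsRDF G g → weight f ≤ weight g)

γR≡ : ∀ {n} → Graph n → ℕ → Set
γR≡ G k = (∃ λ f → IsRDF G f × weight f ≡ k) × (∀ g → IsRDF G g → k ≤ weight g)

UVR : ∀ {m} → Graph (suc m) → Set
UVR G = ∀ v k k' → γR≡ G k → γR≡ (G ─ v) k' → k ≡ k'

InClosedNbhd : ∀ {n} → Graph n → Fin n → Fin n → Set
InClosedNbhd G s w = w ≡ s ⊎ adj G s w ≡ true

EfficientDominating : ∀ {n} → Graph n → (Fin n → Set) → Set
EfficientDominating G S =
  (∀ w → ∃ λ s → S s × InClosedNbhd G s w) ×
  (∀ s s' w → S s → S s' → InClosedNbhd G s w → InClosedNbhd G s' w → s ≡ s')

V₂ : ∀ {n} → (Fin n → Fin 3) → Fin n → Set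
V₂ f v = f v ≡ two

module Submission where

-- If γ_R(G − v) = γ_R(G) for all v, no γ_R-function f takes the value 1: deleting a
-- vertex of value 1 would leave a lighter RDF of G − v. Hence γ_R(G) = 2|V₂|. Every
-- s ∈ V₂ has at least two external private neighbours, since otherwise giving the value 1
-- to s and its private neighbour is again a minimum RDF with a 1. Private neighbours have
-- one owner and lie outside V₂, so 3|V₂| ≤ n. If equality holds the count is tight: every
-- vertex outside V₂ is private to some s, which has exactly two private neighbours, and V₂
-- is independent (lowering s to 0 and its two private neighbours to 1 keeps the weight),
-- so V₂ is efficient with degree-2 vertices. Conversely, if D is efficient with degree-2
-- vertices, charge each vertex to a vertex of V₂ in the closed neighbourhood of its
-- dominator; each vertex of V₂ is charged at most 3 times, so n ≤ 3|V₂|.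

open import Data.Bool using (true; false; if_then_else_)
import Data.Bool.Properties as Bool
open import Data.Empty using (⊥; ⊥-elim)
open import Data.Fin using (Fin; zero; suc; toℕ; punchIn; punchOut; _≟_)
open import Data.Fin.Properties using (punchInᵢ≢i; punchIn-punchOut; any?; all?; ¬∀⟶∃¬)
open import Data.List using (map; allFin; tabulate)
open import Data.List.Properties using (map-tabulate)
import Data.Nat.ListAction as List
open import Data.Nat using (ℕ; zero; suc; _+_; _*_; _≤_; _<_; _≤?_; z≤n; s≤s)
open import Data.Nat.Properties hiding (_≟_)
open import Data.Nat.Induction using (<-rec)
open import Algebra.Properties.Semiring.Sum +-*-semiring
  using (sum; sum-syntax; sum-cong-≗; sum-remove; sum-replicate-zero; ∑-distrib-+; ∑-comm; *-distribˡ-sum)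
open import Data.Product using (∃; _×_; _,_; proj₁; proj₂)
open import Data.Sum using (inj₁; inj₂)
open import Data.Vec.Functional using (Vector)
open import Function using (_∘_; id)
open import Relation.Binary.PropositionalEquality
open import Relation.Nullary using (¬_; Dec; yes; no; _×-dec_; _→-dec_)
open import Relation.Unary using (Pred; Decidable)
open import Defs renaming (sym to adj-sym)

sum-tabulate : ∀ {n} (h : Vector ℕ n) → List.sum (tabulate h) ≡ sum h
sum-tabulate {zero}  h = refl
sum-tabulate {suc n} h = cong (h zero +_) (sum-tabulate (h ∘ suc))

sum-allFin : ∀ n (h : Vector ℕ n) → List.sum (map h (allFin n)) ≡ sum h
sum-allFin n h = trans (cong List.sum (map-tabulate id h)) (sum-tabulate h)

weight≡∑ : ∀ {n} (f : Fin n → Fin 3) → weight f ≡ ∑[ v < n ] toℕ (f v)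
weight≡∑ {n} f = sum-allFin n (toℕ ∘ f)

sum-mono-≤ : ∀ {n} {f g : Vector ℕ n} → (∀ i → f i ≤ g i) → sum f ≤ sum g
sum-mono-≤ {zero}  f≤g = z≤n
sum-mono-≤ {suc n} f≤g = +-mono-≤ (f≤g zero) (sum-mono-≤ (f≤g ∘ suc))

sum-mono-< : ∀ {n} {f g : Vector ℕ n} → (∀ i → f i ≤ g i) → ∀ i → f i < g i → sum f < sum g
sum-mono-< {suc n} {f} {g} f≤g i fi<gi = begin-strict
  sum f                      ≡⟨ sum-remove {i = i} f ⟩
  f i + sum (f ∘ punchIn i)  <⟨ +-mono-<-≤ fi<gi (sum-mono-≤ (f≤g ∘ punchIn i)) ⟩
  g i + sum (g ∘ punchIn i)  ≡⟨ sum-remove {i = i} g ⟨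
  sum g                      ∎
  where open ≤-Reasoning

sum-≤⇒≗ : ∀ {n} {f g : Vector ℕ n} → (∀ i → f i ≤ g i) → sum g ≤ sum f → f ≗ g
sum-≤⇒≗ f≤g ∑g≤∑f i with m≤n⇒m<n∨m≡n (f≤g i)
... | inj₁ fi<gi = ⊥-elim (<⇒≱ (sum-mono-< f≤g i fi<gi) ∑g≤∑f)
... | inj₂ fi≡gi = fi≡gi

sum-single : ∀ {n} (h : Vector ℕ n) i → (∀ j → j ≢ i → h j ≡ 0) → sum h ≡ h i
sum-single {suc n} h i vanish = begin
  sum h                      ≡⟨ sum-remove {i = i} h ⟩
  h i + sum (h ∘ punchIn i)  ≡⟨ cong (h i +_) (sum-cong-≗ (λ j → vanish _ (punchInᵢ≢i i j))) ⟩
  h i + ∑[ j < n ] 0         ≡⟨ cong (h i +_) (sum-replicate-zero n) ⟩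
  h i + 0                    ≡⟨ +-identityʳ (h i) ⟩
  h i                        ∎
  where open ≡-Reasoning

∑1≡n : ∀ n → ∑[ i < n ] 1 ≡ n
∑1≡n zero    = refl
∑1≡n (suc n) = cong suc (∑1≡n n)

ind : ∀ {p} {P : Set p} → Dec P → ℕ
ind (yes _) = 1
ind (no _)  = 0

ind-yes : ∀ {p} {P : Set p} → P → (P? : Dec P) → ind P? ≡ 1
ind-yes _ (yes _) = refl
ind-yes p (no ¬p) = ⊥-elim (¬p p)

ind-no : ∀ {p} {P : Set p} → ¬ P → (P? : Dec P) → ind P? ≡ 0
ind-no ¬p (yes p) = ⊥-elim (¬p p)
ind-no _  (no _)  = refl

module _ {n p} {P : Pred (Fin n) p} (P? : Decidable P) where

  count : ℕ
  count = ∑[ i < n ] ind (P? i)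

  count-none : (∀ i → ¬ P i) → count ≡ 0
  count-none ¬P = trans (sum-cong-≗ (λ i → ind-no (¬P i) (P? i))) (sum-replicate-zero n)

  count-single : ∀ {i} → P i → (∀ j → P j → j ≡ i) → count ≡ 1
  count-single {i} Pi only = trans (sum-single (ind ∘ P?) i (λ j j≢i → ind-no (j≢i ∘ only j) (P? j)))
                                   (ind-yes Pi (P? i))

  count-unique : (∀ i j → P i → P j → i ≡ j) → count ≤ 1
  count-unique unique with any? P?
  ... | yes (i , Pi) = ≤-reflexive (count-single Pi (λ j Pj → unique j i Pj Pi))
  ... | no ∄P        = ≤-trans (≤-reflexive (count-none (λ i Pi → ∄P (i , Pi)))) z≤n

  count-pos : 0 < count → ∃ P
  count-pos 0<count with any? P?
  ... | yes ∃P = ∃P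
  ... | no ∄P  = ⊥-elim (<⇒≢ 0<count (sym (count-none (λ i Pi → ∄P (i , Pi)))))

count-singleton : ∀ {n} (x : Fin n) → count (_≟ x) ≡ 1
count-singleton x = count-single (_≟ x) refl (λ _ j≡x → j≡x)

∑-*-singleton : ∀ {n} a (s : Fin n) → ∑[ x < n ] (a * ind (x ≟ s)) ≡ a
∑-*-singleton a s = begin
  ∑[ x < _ ] (a * ind (x ≟ s))  ≡⟨ *-distribˡ-sum a (λ x → ind (x ≟ s)) ⟨
  a * count (_≟ s)              ≡⟨ cong (a *_) (count-singleton s) ⟩
  a * 1                         ≡⟨ *-identityʳ a ⟩
  a                             ∎
  where open ≡-Reasoning

two≢zero : ∀ {x : Fin 3} → x ≡ two → x ≢ zero
two≢zero refl ()

toℕ≡2*[≟two] : (x : Fin 3) → x ≢ suc zero → toℕ x ≡ 2 * ind (x ≟ two)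
toℕ≡2*[≟two] zero             _   = refl
toℕ≡2*[≟two] (suc zero)       x≢1 = ⊥-elim (x≢1 refl)
toℕ≡2*[≟two] (suc (suc zero)) _   = refl

adjacent⇒≢ : ∀ {n} (G : Graph n) {u w} → adj G u w ≡ true → w ≢ u
adjacent⇒≢ G {u} uw refl with trans (sym uw) (irrefl G u)
... | ()

restrict-isRDF : ∀ {m} (G : Graph (suc m)) {f v} → IsRDF G f → f v ≡ suc zero →
                 IsRDF (G ─ v) (f ∘ punchIn v)
restrict-isRDF G {f} {v} f-rdf fv≡1 i fi≡0 with f-rdf (punchIn v i) fi≡0
... | u , iu , fu≡2 = punchOut v≢u , subst (λ x → adj G (punchIn v i) x ≡ true) (sym (punchIn-punchOut v≢u)) iu ,
                      trans (cong f (punchIn-punchOut v≢u)) fu≡2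
  where
  v≢u : v ≢ u
  v≢u refl with trans (sym fv≡1) fu≡2
  ... | ()

restrict-weight : ∀ {m} (f : Fin (suc m) → Fin 3) {v} → f v ≡ suc zero →
                  weight f ≡ suc (weight (f ∘ punchIn v))
restrict-weight f {v} fv≡1 = begin
  weight f                                 ≡⟨ weight≡∑ f ⟩
  sum (toℕ ∘ f)                            ≡⟨ sum-remove {i = v} (toℕ ∘ f) ⟩
  toℕ (f v) + sum (toℕ ∘ f ∘ punchIn v)
    ≡⟨ cong₂ _+_ (cong toℕ fv≡1) (sym (weight≡∑ (f ∘ punchIn v))) ⟩
  suc (weight (f ∘ punchIn v))             ∎
  where open ≡-Reasoning

-- Only the double negation is constructive; it is used only to refute.
¬¬γR-exists : ∀ {n} (G : Graph n) {g} → IsRDF G g → ¬ ¬ ∃ (γR≡ G)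
¬¬γR-exists G {g} g-rdf ∄γR = <-rec NoRDFOfWeight lightest (weight g) g g-rdf refl
  where
  NoRDFOfWeight : ℕ → Set
  NoRDFOfWeight w = ∀ g → IsRDF G g → weight g ≡ w → ⊥

  lightest : ∀ w → (∀ {w′} → w′ < w → NoRDFOfWeight w′) → NoRDFOfWeight w
  lightest _ lighter g g-rdf refl = ∄γR (weight g , (g , g-rdf , refl) , g-minimal)
    where
    g-minimal : ∀ h → IsRDF G h → weight g ≤ weight h
    g-minimal h h-rdf with weight g ≤? weight h
    ... | yes g≤h = g≤h
    ... | no  g≰h = ⊥-elim (lighter (≰⇒> g≰h) h h-rdf refl)

module _ {m} (G : Graph (suc m)) (uvr : UVR G) {k} (γ : γR≡ G k) where

  γR-≤-vertexDeleted : ∀ v {g} → IsRDF (G ─ v) g → k ≤ weight g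
  γR-≤-vertexDeleted v {g} g-rdf with k ≤? weight g
  ... | yes k≤g = k≤g
  ... | no  k≰g = ⊥-elim (¬¬γR-exists (G ─ v) g-rdf λ (k′ , γ′) →
                    k≰g (subst (_≤ weight g) (sym (uvr v k k′ γ γ′)) (proj₂ γ′ g g-rdf)))

  weight≤γR⇒≢1 : ∀ {g} → IsRDF G g → weight g ≤ k → ∀ v → g v ≢ suc zero
  weight≤γR⇒≢1 {g} g-rdf g≤k v gv≡1 =
    <⇒≱ (subst (_≤ k) (restrict-weight g gv≡1) g≤k) (γR-≤-vertexDeleted v (restrict-isRDF G g-rdf gv≡1))

module PrivateNeighbours {n} (G : Graph n) (f : Fin n → Fin 3) where

  OnlyTwoNeighbour : Fin n → Fin n → Set
  OnlyTwoNeighbour v u = ∀ w → adj G u w ≡ true → f w ≡ two → w ≡ v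

  Private : Fin n → Fin n → Set
  Private v u = f v ≡ two × f u ≡ zero × adj G v u ≡ true × OnlyTwoNeighbour v u

  onlyTwoNeighbour? : ∀ v u → Dec (OnlyTwoNeighbour v u)
  onlyTwoNeighbour? v u = all? (λ w → (adj G u w Bool.≟ true) →-dec (f w ≟ two) →-dec (w ≟ v))

  private? : ∀ v u → Dec (Private v u)
  private? v u = (f v ≟ two) ×-dec (f u ≟ zero) ×-dec (adj G v u Bool.≟ true) ×-dec onlyTwoNeighbour? v u

  privateCount : Fin n → ℕ
  privateCount v = count (private? v)

  owners : Fin n → ℕ
  owners u = count (λ v → private? v u)

  private⇒≢ : ∀ {v u} → Private v u → u ≢ v
  private⇒≢ (fv≡2 , fu≡0 , _) refl = two≢zero fv≡2 fu≡0

  private-onlyTwo : ∀ {v u w} → Private v u → adj G w u ≡ true → f w ≡ two → w ≡ v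
  private-onlyTwo {u = u} {w} (_ , _ , _ , only) wu fw≡2 = only w (trans (adj-sym G u w) wu) fw≡2

  twoNeighbour-≢ : IsRDF G f → ∀ {s x} → f s ≡ two → f x ≡ zero → ¬ Private s x →
                   ∃ λ w → adj G x w ≡ true × f w ≡ two × w ≢ s
  twoNeighbour-≢ f-rdf {s} {x} fs≡2 fx≡0 ¬private with f-rdf x fx≡0
  ... | w , xw , fw≡2 with w ≟ s
  ...   | no w≢s = w , xw , fw≡2 , w≢s
  ...   | yes refl with ¬∀⟶∃¬ n _ (λ w → (adj G x w Bool.≟ true) →-dec (f w ≟ two) →-dec (w ≟ s))
                           (λ only → ¬private (fs≡2 , fx≡0 , trans (adj-sym G s x) xw , only))
  ...     | w′ , ¬only with adj G x w′ Bool.≟ true | f w′ ≟ two | w′ ≟ s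
  ...       | yes xw′ | yes fw′≡2 | no w′≢s  = w′ , xw′ , fw′≡2 , w′≢s
  ...       | no ¬xw′ | _         | _        = ⊥-elim (¬only (⊥-elim ∘ ¬xw′))
  ...       | _       | no fw′≢2  | _        = ⊥-elim (¬only (λ _ → ⊥-elim ∘ fw′≢2))
  ...       | _       | _         | yes w′≡s = ⊥-elim (¬only (λ _ _ → w′≡s))

  reassign : Fin n → Fin 3 → Fin n → Fin 3
  reassign s c x with x ≟ s | private? s x
  ... | yes _ | _     = c
  ... | no _  | yes _ = suc zero
  ... | no _  | no _  = f x

  reassign-at : ∀ s {c} → reassign s c s ≡ c
  reassign-at s with s ≟ s
  ... | yes _  = refl
  ... | no s≢s = ⊥-elim (s≢s refl)

  reassign-private : ∀ {s c x} → Private s x → reassign s c x ≡ suc zero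
  reassign-private {s} {c} {x} sx with x ≟ s | private? s x
  ... | yes x≡s | _          = ⊥-elim (private⇒≢ sx x≡s)
  ... | no _    | yes _      = refl
  ... | no _    | no ¬sx     = ⊥-elim (¬sx sx)

  reassign-two : ∀ {s c w} → f w ≡ two → w ≢ s → reassign s c w ≡ two
  reassign-two {s} {c} {w} fw≡2 w≢s with w ≟ s | private? s w
  ... | yes w≡s | _                   = ⊥-elim (w≢s w≡s)
  ... | no _    | yes (_ , fw≡0 , _)  = ⊥-elim (two≢zero fw≡2 fw≡0)
  ... | no _    | no _                = fw≡2

  reassign-isRDF : IsRDF G f → ∀ {s c} → f s ≡ two →
                   (c ≡ zero → ∃ λ w → adj G s w ≡ true × f w ≡ two) → IsRDF G (reassign s c)
  reassign-isRDF f-rdf {s} {c} fs≡2 dominated x gx≡0 with x ≟ s | private? s x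
  ... | yes refl | _ with dominated gx≡0
  ...   | w , sw , fw≡2 = w , sw , reassign-two fw≡2 (adjacent⇒≢ G sw)
  reassign-isRDF f-rdf fs≡2 dominated x () | no _ | yes _
  reassign-isRDF f-rdf fs≡2 dominated x gx≡0 | no _ | no ¬private
    with twoNeighbour-≢ f-rdf fs≡2 gx≡0 ¬private
  ... | w , xw , fw≡2 , w≢s = w , xw , reassign-two fw≡2 w≢s

  reassign-pointwise : ∀ {s} c → f s ≡ two → ∀ x →
    toℕ (reassign s c x) + 2 * ind (x ≟ s) ≡ toℕ c * ind (x ≟ s) + ind (private? s x) + toℕ (f x)
  reassign-pointwise {s} c fs≡2 x with x ≟ s | private? s x
  ... | yes refl | yes sx     = ⊥-elim (private⇒≢ sx refl)
  ... | yes refl | no _       rewrite fs≡2 | *-identityʳ (toℕ c) | +-identityʳ (toℕ c) = refl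
  ... | no _     | yes (_ , fx≡0 , _) rewrite fx≡0 | *-zeroʳ (toℕ c) = refl
  ... | no _     | no _       rewrite *-zeroʳ (toℕ c) = +-identityʳ (toℕ (f x))

  reassign-weight : ∀ {s} c → f s ≡ two → weight (reassign s c) + 2 ≡ toℕ c + privateCount s + weight f
  reassign-weight {s} c fs≡2 = begin
    weight g + 2
      ≡⟨ cong₂ _+_ (weight≡∑ g) (sym (∑-*-singleton 2 s)) ⟩
    sum (toℕ ∘ g) + ∑[ x < n ] (2 * ind (x ≟ s))
      ≡⟨ ∑-distrib-+ (toℕ ∘ g) _ ⟨
    ∑[ x < n ] (toℕ (g x) + 2 * ind (x ≟ s))
      ≡⟨ sum-cong-≗ (reassign-pointwise c fs≡2) ⟩
    ∑[ x < n ] (toℕ c * ind (x ≟ s) + ind (private? s x) + toℕ (f x))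
      ≡⟨ trans (∑-distrib-+ _ (toℕ ∘ f)) (cong (_+ sum (toℕ ∘ f)) (∑-distrib-+ _ (ind ∘ private? s))) ⟩
    ∑[ x < n ] (toℕ c * ind (x ≟ s)) + privateCount s + sum (toℕ ∘ f)
      ≡⟨ cong₂ (λ a b → a + privateCount s + b) (∑-*-singleton (toℕ c) s) (sym (weight≡∑ f)) ⟩
    toℕ c + privateCount s + weight f
      ∎
    where
    open ≡-Reasoning
    g = reassign s c

γR-function-weight : ∀ {n} (G : Graph n) {k f} → γR≡ G k → IsγRFunction G f → weight f ≡ k
γR-function-weight G ((f₀ , f₀-rdf , f₀-weight) , γR-min) (f-rdf , f-min) =
  ≤-antisym (≤-trans (f-min f₀ f₀-rdf) (≤-reflexive f₀-weight)) (γR-min _ f-rdf)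

module MinimumRDF {m} (G : Graph (suc m)) (uvr : UVR G) {k} (γ : γR≡ G k)
                  {f} (f-rdf : IsRDF G f) (f-weight : weight f ≡ k) where

  open PrivateNeighbours G f

  N : ℕ
  N = suc m

  t : ℕ
  t = count (λ v → f v ≟ two)

  f≢1 : ∀ v → f v ≢ suc zero
  f≢1 = weight≤γR⇒≢1 G uvr γ f-rdf (≤-reflexive f-weight)

  γR≡2t : k ≡ 2 * t
  γR≡2t = begin
    k                                     ≡⟨ f-weight ⟨
    weight f                              ≡⟨ weight≡∑ f ⟩
    sum (toℕ ∘ f)                         ≡⟨ sum-cong-≗ (λ v → toℕ≡2*[≟two] (f v) (f≢1 v)) ⟩
    ∑[ v < N ] (2 * ind (f v ≟ two))      ≡⟨ *-distribˡ-sum 2 (λ v → ind (f v ≟ two)) ⟨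
    2 * t                                 ∎
    where open ≡-Reasoning

  3γR≡2*3t : 3 * k ≡ 2 * (3 * t)
  3γR≡2*3t = trans (cong (3 *_) γR≡2t) (trans (sym (*-assoc 3 2 t)) (*-assoc 2 3 t))

  two≤privateCount : ∀ s → f s ≡ two → 2 ≤ privateCount s
  two≤privateCount s fs≡2 with 2 ≤? privateCount s
  ... | yes 2≤p = 2≤p
  ... | no  2≰p = ⊥-elim (weight≤γR⇒≢1 G uvr γ (reassign-isRDF f-rdf fs≡2 (λ ())) g≤k s (reassign-at s))
    where
    open ≤-Reasoning
    g≤k : weight (reassign s (suc zero)) ≤ k
    g≤k = +-cancelʳ-≤ 2 _ _ (begin
      weight (reassign s (suc zero)) + 2  ≡⟨ reassign-weight (suc zero) fs≡2 ⟩
      suc (privateCount s) + weight f     ≤⟨ +-monoˡ-≤ (weight f) (≰⇒> 2≰p) ⟩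
      2 + weight f                        ≡⟨ +-comm 2 (weight f) ⟩
      weight f + 2                        ≡⟨ cong (_+ 2) f-weight ⟩
      k + 2                               ∎)

  owners+[two]≤1 : ∀ u → owners u + ind (f u ≟ two) ≤ 1
  owners+[two]≤1 u with f u ≟ two
  ... | yes fu≡2 = ≤-reflexive (cong (_+ 1) (count-none (λ v → private? v u)
                     λ _ (_ , fu≡0 , _) → two≢zero fu≡2 fu≡0))
  ... | no  _    = ≤-trans (≤-reflexive (+-identityʳ (owners u))) (count-unique (λ v → private? v u)
                     λ _ _ (fv≡2 , _ , vu , _) v′u → private-onlyTwo v′u vu fv≡2)

  2*[two]≤privateCount : ∀ v → 2 * ind (f v ≟ two) ≤ privateCount v
  2*[two]≤privateCount v = bound (f v ≟ two)
    where
    bound : (fv≡2? : Dec (f v ≡ two)) → 2 * ind fv≡2? ≤ privateCount v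
    bound (yes fv≡2) = two≤privateCount v fv≡2
    bound (no _)     = z≤n

  privatePairs : ℕ
  privatePairs = ∑[ v < N ] privateCount v

  2t≤privatePairs : 2 * t ≤ privatePairs
  2t≤privatePairs = ≤-trans (≤-reflexive (*-distribˡ-sum 2 (λ v → ind (f v ≟ two))))
                            (sum-mono-≤ 2*[two]≤privateCount)

  ∑owners+[two]≡privatePairs+t : ∑[ u < N ] (owners u + ind (f u ≟ two)) ≡ privatePairs + t
  ∑owners+[two]≡privatePairs+t = trans (∑-distrib-+ owners (λ u → ind (f u ≟ two)))
                                       (cong (_+ t) (∑-comm (λ u v → ind (private? v u))))

  ∑owners+[two]≤N : ∑[ u < N ] (owners u + ind (f u ≟ two)) ≤ N
  ∑owners+[two]≤N = ≤-trans (sum-mono-≤ owners+[two]≤1) (≤-reflexive (∑1≡n N))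

  2t≤a⇒3t≤a+t : ∀ {a} → 2 * t ≤ a → 3 * t ≤ a + t
  2t≤a⇒3t≤a+t {a} 2t≤a = subst (_≤ a + t) (+-comm (2 * t) t) (+-monoˡ-≤ t 2t≤a)

  3t≤N : 3 * t ≤ N
  3t≤N = ≤-trans (2t≤a⇒3t≤a+t 2t≤privatePairs)
                 (subst (_≤ N) ∑owners+[two]≡privatePairs+t ∑owners+[two]≤N)

  3γR≤2N : 3 * k ≤ 2 * N
  3γR≤2N = subst (_≤ 2 * N) (sym 3γR≡2*3t) (*-monoʳ-≤ 2 3t≤N)

  module Extremal (3γR≡2N : 3 * k ≡ 2 * N) where

    3t≡N : 3 * t ≡ N
    3t≡N = *-cancelˡ-≡ (3 * t) N 2 (trans (sym 3γR≡2*3t) 3γR≡2N)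

    owners+[two]≡1 : ∀ u → owners u + ind (f u ≟ two) ≡ 1
    owners+[two]≡1 = sum-≤⇒≗ owners+[two]≤1 (begin
      ∑[ u < N ] 1                                 ≡⟨ ∑1≡n N ⟩
      N                                            ≡⟨ 3t≡N ⟨
      3 * t                                        ≤⟨ 2t≤a⇒3t≤a+t 2t≤privatePairs ⟩
      privatePairs + t                             ≡⟨ ∑owners+[two]≡privatePairs+t ⟨
      ∑[ u < N ] (owners u + ind (f u ≟ two))      ∎)
      where open ≤-Reasoning

    privateCount≡2 : ∀ s → f s ≡ two → privateCount s ≡ 2
    privateCount≡2 s fs≡2 = trans (sym (sum-≤⇒≗ 2*[two]≤privateCount privatePairs≤∑ s))
                                  (cong (2 *_) (ind-yes fs≡2 (f s ≟ two)))
      where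
      open ≤-Reasoning
      privatePairs≤∑ : privatePairs ≤ ∑[ v < N ] (2 * ind (f v ≟ two))
      privatePairs≤∑ = +-cancelʳ-≤ t _ _ (begin
        privatePairs + t                            ≡⟨ ∑owners+[two]≡privatePairs+t ⟨
        ∑[ u < N ] (owners u + ind (f u ≟ two))     ≤⟨ ∑owners+[two]≤N ⟩
        N                                           ≡⟨ 3t≡N ⟨
        3 * t                                       ≡⟨ +-comm t (2 * t) ⟩
        2 * t + t                                   ≡⟨ cong (_+ t) (*-distribˡ-sum 2 (λ v → ind (f v ≟ two))) ⟩
        ∑[ v < N ] (2 * ind (f v ≟ two)) + t        ∎)

    owner : ∀ u → f u ≢ two → ∃ λ v → Private v u
    owner u fu≢2 = count-pos (λ v → private? v u) (≤-reflexive (sym owners≡1))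
      where
      open ≡-Reasoning
      owners≡1 : owners u ≡ 1
      owners≡1 = begin
        owners u                       ≡⟨ +-identityʳ (owners u) ⟨
        owners u + 0                   ≡⟨ cong (owners u +_) (ind-no fu≢2 (f u ≟ two)) ⟨
        owners u + ind (f u ≟ two)     ≡⟨ owners+[two]≡1 u ⟩
        1                              ∎

    privateNeighbour : ∀ {s} → f s ≡ two → ∃ (Private s)
    privateNeighbour {s} fs≡2 = count-pos (private? s) (subst (0 <_) (sym (privateCount≡2 s fs≡2)) (s≤s z≤n))

    V₂-independent : ∀ {s s′} → f s ≡ two → f s′ ≡ two → adj G s s′ ≢ true
    V₂-independent {s} {s′} fs≡2 fs′≡2 ss′ =
      weight≤γR⇒≢1 G uvr γ (reassign-isRDF f-rdf fs≡2 (λ _ → s′ , ss′ , fs′≡2)) g≤k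
        (proj₁ (privateNeighbour fs≡2)) (reassign-private (proj₂ (privateNeighbour fs≡2)))
      where
      open ≡-Reasoning
      g≤k : weight (reassign s zero) ≤ k
      g≤k = ≤-reflexive (+-cancelʳ-≡ 2 _ _ (begin
        weight (reassign s zero) + 2   ≡⟨ reassign-weight zero fs≡2 ⟩
        privateCount s + weight f      ≡⟨ cong₂ _+_ (privateCount≡2 s fs≡2) f-weight ⟩
        2 + k                          ≡⟨ +-comm 2 k ⟩
        k + 2                          ∎))

    V₂-efficient : EfficientDominating G (V₂ f)
    V₂-efficient = covers , disjoint
      where
      covers : ∀ w → ∃ λ s → V₂ f s × InClosedNbhd G s w
      covers w with f w ≟ two
      ... | yes fw≡2 = w , fw≡2 , inj₁ refl
      ... | no  fw≢2 = let s , fs≡2 , _ , sw , _ = owner w fw≢2 in s , fs≡2 , inj₂ sw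

      disjoint : ∀ s s′ w → V₂ f s → V₂ f s′ → InClosedNbhd G s w → InClosedNbhd G s′ w → s ≡ s′
      disjoint s s′ w _   _    (inj₁ refl) (inj₁ refl) = refl
      disjoint s s′ w fs  fs′  (inj₁ refl) (inj₂ s′w)  = ⊥-elim (V₂-independent fs′ fs s′w)
      disjoint s s′ w fs  fs′  (inj₂ sw)   (inj₁ refl) = ⊥-elim (V₂-independent fs fs′ sw)
      disjoint s s′ w fs  fs′  (inj₂ sw)   (inj₂ s′w) with f w ≟ two
      ... | yes fw≡2 = ⊥-elim (V₂-independent fs fw≡2 sw)
      ... | no  fw≢2 = let _ , vw = owner w fw≢2 in
        trans (private-onlyTwo vw sw fs) (sym (private-onlyTwo vw s′w fs′))

    adjacent≡private : ∀ {v} → f v ≡ two → ∀ u → (if adj G v u then 1 else 0) ≡ ind (private? v u)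
    adjacent≡private {v} fv≡2 u = compare (adj G v u) refl
      where
      compare : ∀ b → adj G v u ≡ b → (if b then 1 else 0) ≡ ind (private? v u)
      compare false vu≢ = sym (ind-no ¬private (private? v u))
        where
        ¬private : ¬ Private v u
        ¬private (_ , _ , vu , _) with trans (sym vu) vu≢
        ... | ()
      compare true vu with f u ≟ two
      ... | yes fu≡2 = ⊥-elim (V₂-independent fv≡2 fu≡2 vu)
      ... | no  fu≢2 = let _ , v′u = owner u fu≢2 in
        sym (ind-yes (subst (λ x → Private x u) (sym (private-onlyTwo v′u vu fv≡2)) v′u) (private? v u))

    V₂-degree : ∀ v → V₂ f v → deg G v ≡ 2
    V₂-degree v fv≡2 = begin
      deg G v                                   ≡⟨ sum-allFin N _ ⟩
      ∑[ u < N ] (if adj G v u then 1 else 0)   ≡⟨ sum-cong-≗ (adjacent≡private fv≡2) ⟩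
      privateCount v                            ≡⟨ privateCount≡2 v fv≡2 ⟩
      2                                         ∎
      where open ≡-Reasoning

module EfficientDegreeTwo {n} (G : Graph n) {f} (f-rdf : IsRDF G f) (f≢1 : ∀ v → f v ≢ suc zero)
                          {D} (D-efficient : EfficientDominating G D) (D-deg : ∀ d → D d → deg G d ≡ 2) where

  twoInClosedNbhd : ∀ d → ∃ λ x → f x ≡ two × InClosedNbhd G d x
  twoInClosedNbhd d with f d in fd
  ... | zero           = let u , du , fu≡2 = f-rdf d fd in u , fu≡2 , inj₂ du
  ... | suc zero       = ⊥-elim (f≢1 d fd)
  ... | suc (suc zero) = d , fd , inj₁ refl

  dominator : Fin n → Fin n
  dominator w = proj₁ (proj₁ D-efficient w)

  dominator∈D : ∀ w → D (dominator w)
  dominator∈D w = proj₁ (proj₂ (proj₁ D-efficient w))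

  dominator-dominates : ∀ w → InClosedNbhd G (dominator w) w
  dominator-dominates w = proj₂ (proj₂ (proj₁ D-efficient w))

  φ : Fin n → Fin n
  φ w = proj₁ (twoInClosedNbhd (dominator w))

  φ-two : ∀ w → f (φ w) ≡ two
  φ-two w = proj₁ (proj₂ (twoInClosedNbhd (dominator w)))

  φ-near : ∀ w → InClosedNbhd G (dominator w) (φ w)
  φ-near w = proj₂ (proj₂ (twoInClosedNbhd (dominator w)))

  closedNbhdIndicator : Fin n → Fin n → ℕ
  closedNbhdIndicator d w = ind (w ≟ d) + (if adj G d w then 1 else 0)

  ∑closedNbhdIndicator : ∀ d → ∑[ w < n ] closedNbhdIndicator d w ≡ suc (deg G d)
  ∑closedNbhdIndicator d = trans (∑-distrib-+ (λ w → ind (w ≟ d)) _)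
                                 (cong₂ _+_ (count-singleton d) (sym (sum-allFin n _)))

  closedNbhd⇒indicator : ∀ {d w} → InClosedNbhd G d w → 1 ≤ closedNbhdIndicator d w
  closedNbhd⇒indicator {d} {w} (inj₁ w≡d) = ≤-trans (≤-reflexive (sym (ind-yes w≡d (w ≟ d)))) (m≤m+n _ _)
  closedNbhd⇒indicator {d} {w} (inj₂ dw) rewrite dw = m≤n+m 1 (ind (w ≟ d))

  -- All vertices charged to v have v in the closed neighbourhoods of their dominators,
  -- so by disjointness they share one dominator d₀ and lie in N[d₀].
  fibre≤3*[two] : ∀ v → count (λ w → v ≟ φ w) ≤ 3 * ind (f v ≟ two)
  fibre≤3*[two] v with any? (λ w → v ≟ φ w)
  ... | no  ∄w = ≤-trans (≤-reflexive (count-none (λ w → v ≟ φ w) (λ w v≡φw → ∄w (w , v≡φw)))) z≤n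
  ... | yes (w₀ , v≡φw₀) = begin
    count (λ w → v ≟ φ w)                  ≤⟨ sum-mono-≤ (λ w → fibre⊆closedNbhd w (v ≟ φ w)) ⟩
    ∑[ w < n ] closedNbhdIndicator d₀ w    ≡⟨ ∑closedNbhdIndicator d₀ ⟩
    suc (deg G d₀)                         ≡⟨ cong suc (D-deg d₀ (dominator∈D w₀)) ⟩
    3                                      ≡⟨ cong (3 *_) (ind-yes fv≡2 (f v ≟ two)) ⟨
    3 * ind (f v ≟ two)                    ∎
    where
    open ≤-Reasoning
    d₀ = dominator w₀

    fv≡2 : f v ≡ two
    fv≡2 = subst (λ x → f x ≡ two) (sym v≡φw₀) (φ-two w₀)

    fibre⊆closedNbhd : ∀ w (v≡φw? : Dec (v ≡ φ w)) → ind v≡φw? ≤ closedNbhdIndicator d₀ w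
    fibre⊆closedNbhd w (no _)     = z≤n
    fibre⊆closedNbhd w (yes v≡φw) =
      closedNbhd⇒indicator (subst (λ d → InClosedNbhd G d w) same-dominator (dominator-dominates w))
      where
      same-dominator : dominator w ≡ d₀
      same-dominator = proj₂ D-efficient _ _ v (dominator∈D w) (dominator∈D w₀)
        (subst (InClosedNbhd G _) (sym v≡φw) (φ-near w)) (subst (InClosedNbhd G _) (sym v≡φw₀) (φ-near w₀))

  order≤3*|V₂| : n ≤ 3 * count (λ v → f v ≟ two)
  order≤3*|V₂| = begin
    n                                        ≡⟨ ∑1≡n n ⟨
    ∑[ w < n ] 1                             ≡⟨ sum-cong-≗ (λ w → count-singleton (φ w)) ⟨
    ∑[ w < n ] ∑[ v < n ] ind (v ≟ φ w)      ≡⟨ ∑-comm (λ w v → ind (v ≟ φ w)) ⟩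
    ∑[ v < n ] count (λ w → v ≟ φ w)         ≤⟨ sum-mono-≤ fibre≤3*[two] ⟩
    ∑[ v < n ] (3 * ind (f v ≟ two))         ≡⟨ *-distribˡ-sum 3 (λ v → ind (f v ≟ two)) ⟨
    3 * count (λ v → f v ≟ two)              ∎
    where open ≤-Reasoning

mainTheorem3 : (m : ℕ) (G : Graph (suc m)) → UVR G → Connected G →
    ((k : ℕ) → γR≡ G k → 3 * k ≤ 2 * suc m)
    × ((k : ℕ) → γR≡ G k → 3 * k ≡ 2 * suc m →
        (f : Fin (suc m) → Fin 3) → IsγRFunction G f →
        EfficientDominating G (V₂ f) × ((v : Fin (suc m)) → V₂ f v → deg G v ≡ 2))
    × ((D : Fin (suc m) → Set) → EfficientDominating G D →
        ((v : Fin (suc m)) → D v → deg G v ≡ 2) →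
        (k : ℕ) → γR≡ G k → 3 * k ≡ 2 * suc m)
mainTheorem3 m G uvr _ = upperBound , extremal , converse
  where
  upperBound : (k : ℕ) → γR≡ G k → 3 * k ≤ 2 * suc m
  upperBound k γ@((f , f-rdf , f-weight) , _) = MinimumRDF.3γR≤2N G uvr γ f-rdf f-weight

  extremal : (k : ℕ) → γR≡ G k → 3 * k ≡ 2 * suc m → (f : Fin (suc m) → Fin 3) → IsγRFunction G f →
             EfficientDominating G (V₂ f) × ((v : Fin (suc m)) → V₂ f v → deg G v ≡ 2)
  extremal k γ 3k≡2n f f-γR = V₂-efficient , V₂-degree
    where open MinimumRDF.Extremal G uvr γ (proj₁ f-γR) (γR-function-weight G γ f-γR) 3k≡2n

  converse : (D : Fin (suc m) → Set) → EfficientDominating G D → ((v : Fin (suc m)) → D v → deg G v ≡ 2) →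
             (k : ℕ) → γR≡ G k → 3 * k ≡ 2 * suc m
  converse D D-efficient D-deg k γ@((f , f-rdf , f-weight) , _) = ≤-antisym 3γR≤2N (begin
    2 * suc m        ≤⟨ *-monoʳ-≤ 2 (EfficientDegreeTwo.order≤3*|V₂| G f-rdf f≢1 D-efficient D-deg) ⟩
    2 * (3 * t)      ≡⟨ 3γR≡2*3t ⟨
    3 * k            ∎)
    where
    open MinimumRDF G uvr γ f-rdf f-weight
    open ≤-Reasoning
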